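{- Let $n\geq 1$ be an integer and let $D(n+1)$ denote the diameter of $ST_{n+1}$. For $2\leq i\leq n+1$ let $C_i$ be the set of vertices $\sigma_1\sigma_2\ldots\sigma_{n+1}$ of $ST_{n+1}$ with $\sigma_1=i$, and for $\omega\geq 0$ let $V^i_\omega(n+1)$ be the set of vertices of $C_i$ whose weight in $ST_{n+1}$ is $\omega$. Then, for every $i$ with $2\leq i\leq n+1$: (1) $|V_0^i(n+1)|=0$; (2) $|V_\omega^i(n+1)|=|V_{\omega-1}(n)|$ for $\omega=1,2,\ldots,2\lfloor\frac{D(n+1)}{2}\rfloor$; (3) if $n$ is even, then $|V^i_{D(n+1)}(n+1)|=0$.
   Context: For an integer $m>1$, the star graph $ST_m$ is the Cayley graph of the symmetric group $S_m$ with generating set $\{(1\;j): j=2,\ldots,m\}$: its vertices are the permutations $\sigma_1\sigma_2\ldots\sigma_m$ of $\{1,\ldots,m\}$ (with $\sigma_j$ the image of $j$), and two vertices are adjacent iff one is obtained from the other by swapping the entries in positions $1$ and $j$ for some $j\in\{2,\ldots,m\}$ (for $m=1$, $ST_1$ is the single vertex $1$). The weight of a vertex is its graph distance to the identity permutation $12\ldots m$. For $\omega\geq 0$, $V_\omega(n)$ denotes the set of vertices of $ST_n$ of weight $\omega$. -}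

module Defs where

open import Data.Nat using (ℕ; zero; suc; _<_)
open import Data.Fin using (Fin)
open import Data.Vec using (Vec; []; _∷_; lookup; _[_]≔_; allFin; toList; head)
open import Data.List using (List; length)
open import Data.List.Relation.Unary.Unique.Propositional using (Unique)
open import Data.List.Membership.Propositional using (_∈_)
open import Data.List.Relation.Binary.Permutation.Propositional using (_↭_)
open import Data.Product using (Σ; _×_; ∃; ∃-syntax)
open import Data.Empty using (⊥)
open import Relation.Nullary using (¬_)
open import Relation.Binary.PropositionalEquality using (_≡_)
open import Function.Bundles using (_⇔_)

-- Convention: the symbols {1,…,m} are encoded as Fin m = {0,…,m-1};
-- a vertex σ₁σ₂…σₘ is the vector (σ₁ ∷ σ₂ ∷ … ∷ σₘ ∷ []).

IsPerm : {m : ℕ} → Vec (Fin m) m → Set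
IsPerm {m} v = toList v ↭ toList (allFin m)

-- swap entries in position 1 and position (j+2) (positions 1-based)
swap1 : {A : Set} {k : ℕ} → Vec A (suc k) → Fin k → Vec A (suc k)
swap1 (x ∷ xs) j = lookup xs j ∷ (xs [ j ]≔ x)

Adj : {m : ℕ} → Vec (Fin m) m → Vec (Fin m) m → Set
Adj {zero}  u v = ⊥
Adj {suc k} u v = ∃[ j ] (v ≡ swap1 u j)

data Walk {m : ℕ} : Vec (Fin m) m → Vec (Fin m) m → ℕ → Set where
  here : ∀ {u} → Walk u u 0
  step : ∀ {u v w d} → Adj u v → Walk v w d → Walk u w (suc d)

Dist : {m : ℕ} → Vec (Fin m) m → Vec (Fin m) m → ℕ → Set
Dist u v d = Walk u v d × (∀ d′ → d′ < d → ¬ Walk u v d′)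

identity : (m : ℕ) → Vec (Fin m) m
identity m = allFin m

Weight : {m : ℕ} → Vec (Fin m) m → ℕ → Set
Weight {m} v ω = Dist v (identity m) ω

V : (m ω : ℕ) → Vec (Fin m) m → Set
V m ω v = IsPerm v × Weight v ω

Vi : (n : ℕ) → Fin (suc n) → ℕ → Vec (Fin (suc n)) (suc n) → Set
Vi n i ω v = V (suc n) ω v × head v ≡ i

IsDiameter : ℕ → ℕ → Set
IsDiameter m D =
  (∃[ u ] ∃[ v ] (IsPerm {m} u × IsPerm v × Dist u v D)) ×
  (∀ u v d → IsPerm {m} u → IsPerm v → Dist u v d → d Data.Nat.≤ D)

HasSize : {A : Set} → (A → Set) → ℕ → Set
HasSize {A} P k = Σ (List A) λ xs → length xs ≡ k × Unique xs × (∀ a → (a ∈ xs) ⇔ P a)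

-- Fix i ≠ 1. Deleting i from its cycle (contract) sends ST_{n+1} to ST_n; a star
-- swap either acts on the contracted vertex or leaves it unchanged, and bringing i
-- home forces a swap of the second kind. Extending a vertex of ST_n by the fixed
-- point i and swapping i to the front (embed) inverts this on C_i, so a vertex of
-- C_i has weight one more than its contraction: this gives (1), and (2) for every
-- ω ≥ 1. For (3), induction on m bounds every weight in ST_{m+1} by 3m/2, so the
-- weights in C_i are at most 1 + 3(n-1)/2. For even n, the vertex 1 followed by
-- 2…n+1 with consecutive pairs exchanged has weight at least 3n/2, because the
-- number of misplaced entries plus crossed pairs drops by at most one per swap;
-- so D ≥ 3n/2, beyond every weight in C_i.
module Submission where

open import Defs
open import Data.Nat using (ℕ; zero; suc; _≤_; _∸_; _*_; _/_; _%_)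
open import Data.Fin using (Fin)
open import Data.Product using (_×_; ∃-syntax)
open import Relation.Binary.PropositionalEquality using (_≡_; _≢_)

open import Data.Nat using (_+_; _<_; z≤n; s≤s)
import Data.Nat.Properties as ℕ
open import Data.Nat.Divisibility using (m%n≡0⇒n∣m; divides)
open import Data.Fin using (zero; suc; punchIn; punchOut; pinch; _≟_) renaming (_<_ to _<ᶠ_)
import Data.Fin.Properties as Fin
open import Data.Vec using (Vec; []; _∷_; lookup; _[_]≔_; toList; head; tail; tabulate)
import Data.Vec.Properties as Vec
open import Data.Vec.Membership.Propositional.Properties using (∈-lookup; ∈-toList⁺; ∈-toList⁻)
open import Data.Vec.Relation.Unary.Any using (index)
open import Data.Vec.Relation.Unary.Any.Properties using (lookup-index)
open import Data.List using (List; []; _∷_; length; filter; map; cartesianProductWith; allFin)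
import Data.List.Properties as List
open import Data.List.Relation.Unary.All as All using ([]; _∷_)
open import Data.List.Relation.Unary.AllPairs using ([]; _∷_)
open import Data.List.Relation.Unary.Any using (here)
open import Data.List.Relation.Unary.Unique.Propositional using (Unique)
import Data.List.Relation.Unary.Unique.Propositional.Properties as Unique
open import Data.List.Membership.Propositional using (_∈_)
import Data.List.Membership.Propositional.Properties as ∈
open import Data.List.Membership.Propositional.Properties.WithK using (unique∧set⇒bag)
open import Data.List.Relation.Binary.BagAndSetEquality using (∼bag⇒↭)
open import Data.List.Relation.Binary.Permutation.Propositional using (_↭_; ↭-refl; ↭-sym; ↭⇒↭ₛ; prep; swap)
import Data.List.Relation.Binary.Permutation.Setoid.Properties as PermutationₛProperties
open import Data.Product using (_,_; proj₁; proj₂)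
open import Data.Sum using (_⊎_; inj₁; inj₂)
open import Data.Empty using (⊥-elim)
open import Relation.Nullary using (¬_; Dec; yes; no; does)
open import Data.Bool using (if_then_else_; _∧_)
open import Relation.Nullary.Decidable using (map′; _×-dec_; _→-dec_; ¬?)
open import Relation.Unary using (Decidable)
open import Relation.Binary.Definitions using (DecidableEquality)
open import Relation.Binary.PropositionalEquality using (refl; sym; trans; cong; subst; subst₂; setoid; module ≡-Reasoning)
open import Function using (_∘_; Injective; mk⇔; Equivalence)

private
  variable
    A B : Set
    m n l : ℕ

Vertex : ℕ → Set
Vertex m = Vec (Fin m) m

lookup-extensional : (u v : Vec A n) → (∀ p → lookup u p ≡ lookup v p) → u ≡ v
lookup-extensional u v eq = begin
  u                   ≡⟨ Vec.tabulate∘lookup u ⟨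
  tabulate (lookup u) ≡⟨ Vec.tabulate-cong eq ⟩
  tabulate (lookup v) ≡⟨ Vec.tabulate∘lookup v ⟩
  v                   ∎
  where open ≡-Reasoning

head≡lookup-zero : (v : Vec A (suc n)) → head v ≡ lookup v zero
head≡lookup-zero (x ∷ v) = refl

punchIn-cover : (i j : Fin (suc n)) → j ≡ i ⊎ ∃[ j′ ] j ≡ punchIn i j′
punchIn-cover i j with j ≟ i
... | yes j≡i = inj₁ j≡i
... | no j≢i = inj₂ (punchOut (j≢i ∘ sym) , sym (Fin.punchIn-punchOut (j≢i ∘ sym)))

pinch-punchIn : (k q : Fin n) → pinch k (punchIn (suc k) q) ≡ q
pinch-punchIn {suc n} k zero = refl
pinch-punchIn {suc n} zero (suc q) = refl
pinch-punchIn {suc n} (suc k) (suc q) = cong suc (pinch-punchIn k q)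

punchIn-pinch : (k : Fin n) (p : Fin (suc n)) → p ≢ suc k → punchIn (suc k) (pinch k p) ≡ p
punchIn-pinch {suc n} k zero p≢k = refl
punchIn-pinch {suc n} zero (suc zero) p≢k = ⊥-elim (p≢k refl)
punchIn-pinch {suc n} zero (suc (suc p)) p≢k = refl
punchIn-pinch {suc n} (suc k) (suc p) p≢k = cong suc (punchIn-pinch k p (p≢k ∘ cong suc))

pinch≡0 : (k : Fin (suc n)) (t : Fin (suc (suc n))) → t ≢ suc k → pinch k t ≡ zero → t ≡ zero
pinch≡0 k t t≢k eq = trans (sym (punchIn-pinch k t t≢k)) (cong (punchIn (suc k)) eq)

transpose₀ : Fin n → Fin (suc n) → Fin (suc n)
transpose₀ j zero = suc j
transpose₀ j (suc p) with p ≟ j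
... | yes _ = zero
... | no _ = suc p

transpose₀-self : (j : Fin n) → transpose₀ j (suc j) ≡ zero
transpose₀-self j with j ≟ j
... | yes _ = refl
... | no j≢j = ⊥-elim (j≢j refl)

transpose₀-other : (j p : Fin n) → p ≢ j → transpose₀ j (suc p) ≡ suc p
transpose₀-other j p p≢j with p ≟ j
... | yes p≡j = ⊥-elim (p≢j p≡j)
... | no _ = refl

transpose₀-involutive : (j : Fin n) (p : Fin (suc n)) → transpose₀ j (transpose₀ j p) ≡ p
transpose₀-involutive j zero = transpose₀-self j
transpose₀-involutive j (suc p) with p ≟ j
... | yes refl = refl
... | no p≢j = transpose₀-other j p p≢j

transpose₀-injective : (j : Fin n) → Injective _≡_ _≡_ (transpose₀ j)
transpose₀-injective j {p} {q} eq = begin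
  p                             ≡⟨ transpose₀-involutive j p ⟨
  transpose₀ j (transpose₀ j p) ≡⟨ cong (transpose₀ j) eq ⟩
  transpose₀ j (transpose₀ j q) ≡⟨ transpose₀-involutive j q ⟩
  q                             ∎
  where open ≡-Reasoning

lookup-swap1 : (v : Vec A (suc n)) (j : Fin n) (p : Fin (suc n)) →
               lookup (swap1 v j) p ≡ lookup v (transpose₀ j p)
lookup-swap1 (x ∷ xs) j zero = refl
lookup-swap1 (x ∷ xs) j (suc p) with p ≟ j
... | yes refl = Vec.lookup∘update p xs x
... | no p≢j = Vec.lookup∘update′ p≢j xs x

swap1-involutive : (v : Vec A (suc n)) (j : Fin n) → swap1 (swap1 v j) j ≡ v
swap1-involutive v j = lookup-extensional _ _ λ p → begin
  lookup (swap1 (swap1 v j) j) p           ≡⟨ lookup-swap1 (swap1 v j) j p ⟩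
  lookup (swap1 v j) (transpose₀ j p)      ≡⟨ lookup-swap1 v j (transpose₀ j p) ⟩
  lookup v (transpose₀ j (transpose₀ j p)) ≡⟨ cong (lookup v) (transpose₀-involutive j p) ⟩
  lookup v p                               ∎
  where open ≡-Reasoning

Distinct : Vec A n → Set
Distinct v = Injective _≡_ _≡_ (lookup v)

distinct-tail : ∀ {a : A} {xs : Vec A n} → Distinct (a ∷ xs) → Distinct xs
distinct-tail distinct = Fin.suc-injective ∘ distinct

distinct-pair : ∀ {a b : A} {xs : Vec A n} → Distinct (a ∷ b ∷ xs) → a ≢ b
distinct-pair distinct a≡b with distinct {zero} {suc zero} a≡b
... | ()

distinct-drop₂ : ∀ {a b : A} {xs : Vec A n} → Distinct (a ∷ b ∷ xs) → Distinct xs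
distinct-drop₂ = distinct-tail ∘ distinct-tail

swap1-distinct : (v : Vec A (suc n)) (j : Fin n) → Distinct v → Distinct (swap1 v j)
swap1-distinct v j v-distinct {p} {q} eq = transpose₀-injective j (v-distinct (begin
  lookup v (transpose₀ j p) ≡⟨ lookup-swap1 v j p ⟨
  lookup (swap1 v j) p      ≡⟨ eq ⟩
  lookup (swap1 v j) q      ≡⟨ lookup-swap1 v j q ⟩
  lookup v (transpose₀ j q) ∎))
  where open ≡-Reasoning

∈-toList⇒lookup : (v : Vec A n) {x : A} → x ∈ toList v → ∃[ p ] lookup v p ≡ x
∈-toList⇒lookup v x∈v = index (∈-toList⁻ x∈v) , sym (lookup-index (∈-toList⁻ x∈v))

unique⇒distinct : (v : Vec A n) → Unique (toList v) → Distinct v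
unique⇒distinct (x ∷ v) u {zero} {zero} eq = refl
unique⇒distinct (x ∷ v) (x∉v ∷ u) {zero} {suc q} eq = ⊥-elim (All.lookup x∉v (∈-toList⁺ (∈-lookup q v)) eq)
unique⇒distinct (x ∷ v) (x∉v ∷ u) {suc p} {zero} eq = ⊥-elim (All.lookup x∉v (∈-toList⁺ (∈-lookup p v)) (sym eq))
unique⇒distinct (x ∷ v) (x∉v ∷ u) {suc p} {suc q} eq = cong suc (unique⇒distinct v u eq)

distinct⇒unique : (v : Vec A n) → Distinct v → Unique (toList v)
distinct⇒unique [] v-distinct = []
distinct⇒unique (x ∷ v) v-distinct =
  All.tabulate x∉v ∷ distinct⇒unique v (distinct-tail v-distinct)
  where
  x∉v : ∀ {y} → y ∈ toList v → x ≢ y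
  x∉v y∈v x≡y with ∈-toList⇒lookup v y∈v
  ... | p , vp≡y with v-distinct {zero} {suc p} (trans x≡y (sym vp≡y))
  ... | ()

distinct⇒surjective : (v : Vertex n) → Distinct v → ∀ s → ∃[ p ] lookup v p ≡ s
distinct⇒surjective {zero} [] _ ()
distinct⇒surjective {suc n} v v-distinct s with Fin.any? (λ p → lookup v p ≟ s)
... | yes hit = hit
... | no miss = ⊥-elim (collision-free (Fin.pigeonhole (ℕ.n<1+n n) (λ p → punchOut (s≢vp p))))
  where
  s≢vp : ∀ p → s ≢ lookup v p
  s≢vp p s≡vp = miss (p , sym s≡vp)
  collision-free : ¬ (∃[ p ] ∃[ q ] (p <ᶠ q × punchOut (s≢vp p) ≡ punchOut (s≢vp q)))
  collision-free (p , q , p<q , eq) = Fin.<-irrefl (v-distinct (Fin.punchOut-injective (s≢vp p) (s≢vp q) eq)) p<q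

identity-distinct : Distinct (identity n)
identity-distinct {x = p} {q} eq = trans (sym (Vec.lookup-allFin p)) (trans eq (Vec.lookup-allFin q))

identity-unique : Unique (toList (identity n))
identity-unique = distinct⇒unique (identity _) identity-distinct

isPerm⇒distinct : (v : Vertex n) → IsPerm v → Distinct v
isPerm⇒distinct {n} v v↭id = unique⇒distinct v (Unique-resp-↭ (↭⇒↭ₛ (↭-sym v↭id)) identity-unique)
  where open PermutationₛProperties (setoid (Fin n)) using (Unique-resp-↭)

distinct⇒isPerm : (v : Vertex n) → Distinct v → IsPerm v
distinct⇒isPerm {n} v v-distinct =
  ∼bag⇒↭ (unique∧set⇒bag (distinct⇒unique v v-distinct) identity-unique (mk⇔ (λ _ → ∈-id) ∈-v))
  where
  ∈-id : ∀ {x} → x ∈ toList (identity n)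
  ∈-id {x} = subst (_∈ toList (identity n)) (Vec.lookup-allFin x) (∈-toList⁺ (∈-lookup x (identity n)))
  ∈-v : ∀ {x} → x ∈ toList (identity n) → x ∈ toList v
  ∈-v {x} _ with distinct⇒surjective v v-distinct x
  ... | p , refl = ∈-toList⁺ (∈-lookup p v)

-- Dist u v is Least (Walk u v), so these lemmas apply to distances and weights.
Least : (ℕ → Set) → ℕ → Set
Least P d = P d × (∀ d′ → d′ < d → ¬ P d′)

module _ {P Q : ℕ → Set} (up : ∀ {d} → P d → Q (suc d)) (down : ∀ {d} → Q d → ∃[ e ] (e < d × P e)) where

  least-suc : ∀ {e} → Least P e → Least Q (suc e)
  least-suc (pe , below-e) = up pe , λ d′ d′≤e qd′ →
    let (e′ , e′<d′ , pe′) = down qd′ in below-e e′ (ℕ.<-≤-trans e′<d′ (ℕ.≤-pred d′≤e)) pe′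

  least-pred : ∀ {d} → Least Q d → ∃[ e ] (d ≡ suc e × Least P e)
  least-pred {d} (qd , below-d) with down qd
  ... | e , e<d , pe = e , d≡1+e , pe , λ e′ e′<e pe′ →
    below-d (suc e′) (ℕ.<-≤-trans (s≤s e′<e) (ℕ.≤-reflexive (sym d≡1+e))) (up pe′)
    where
    d≡1+e : d ≡ suc e
    d≡1+e = ℕ.≤-antisym (ℕ.≮⇒≥ (λ 1+e<d → below-d (suc e) 1+e<d (up pe))) e<d

least-witness : {P : ℕ → Set} → Decidable P → ∀ {n} → P n → ∃[ d ] Least P d
least-witness {P} P? = below _ ℕ.≤-refl
  where
  below : ∀ bound {n} → n ≤ bound → P n → ∃[ d ] Least P d
  below bound {n} n≤bound pn with ℕ.anyUpTo? P? n
  below bound {n} n≤bound pn | no none = n , pn , λ d d<n pd → none (d , d<n , pd)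
  below zero n≤bound pn | yes (d , d<n , pd) = ⊥-elim (ℕ.n≮0 (ℕ.<-≤-trans d<n n≤bound))
  below (suc bound) n≤bound pn | yes (d , d<n , pd) = below bound (ℕ.≤-pred (ℕ.≤-trans d<n n≤bound)) pd

least? : {P : ℕ → Set} → Decidable P → Decidable (Least P)
least? P? d = P? d ×-dec map′ (λ below d′ → below {d′}) (λ below {d′} → below d′) (ℕ.allUpTo? (¬? ∘ P?) d)

HasSize-empty : {P : A → Set} → (∀ a → ¬ P a) → HasSize P 0
HasSize-empty none = [] , refl , [] , λ a → mk⇔ (λ ()) (⊥-elim ∘ none a)

HasSize-filter : {P : A → Set} (P? : Decidable P) (xs : List A) → Unique xs → (∀ a → a ∈ xs) →
                 HasSize P (length (filter P? xs))
HasSize-filter P? xs xs-unique complete =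
  filter P? xs , refl , Unique.filter⁺ P? xs-unique ,
  λ a → mk⇔ (proj₂ ∘ ∈.∈-filter⁻ P? {xs = xs}) (∈.∈-filter⁺ P? (complete a))

HasSize-image : {P : A → Set} {Q : B → Set} (f : A → B) → Injective _≡_ _≡_ f →
                (∀ {a} → P a → Q (f a)) → (∀ {b} → Q b → ∃[ a ] (P a × f a ≡ b)) →
                ∀ {s} → HasSize P s → HasSize Q s
HasSize-image {Q = Q} f f-injective P⇒Q Q⇒P (xs , length≡s , xs-unique , xs⇔P) =
  map f xs , trans (List.length-map f xs) length≡s , Unique.map⁺ f-injective xs-unique , λ b → mk⇔ to from
  where
  to : ∀ {b} → b ∈ map f xs → Q b
  to b∈ with ∈.∈-map⁻ f b∈
  ... | a , a∈xs , refl = P⇒Q (Equivalence.to (xs⇔P a) a∈xs)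
  from : ∀ {b} → Q b → b ∈ map f xs
  from qb with Q⇒P qb
  ... | a , pa , refl = ∈.∈-map⁺ f (Equivalence.from (xs⇔P a) pa)

vectors : List A → ∀ l → List (Vec A l)
vectors xs zero = [] ∷ []
vectors xs (suc l) = cartesianProductWith _∷_ xs (vectors xs l)

vectors-unique : (xs : List A) → Unique xs → ∀ l → Unique (vectors xs l)
vectors-unique xs xs-unique zero = [] ∷ []
vectors-unique xs xs-unique (suc l) =
  Unique.cartesianProductWith⁺ _∷_ (λ eq → Vec.∷-injectiveˡ eq , Vec.∷-injectiveʳ eq) xs-unique (vectors-unique xs xs-unique l)

vectors-complete : (xs : List A) → (∀ a → a ∈ xs) → (v : Vec A l) → v ∈ vectors xs l
vectors-complete xs complete [] = here refl
vectors-complete xs complete (a ∷ v) = ∈.∈-cartesianProductWith⁺ _∷_ (complete a) (vectors-complete xs complete v)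

walk? : (u v : Vertex (suc m)) → Decidable (Walk u v)
walk? u v zero with Vec.≡-dec _≟_ u v
... | yes refl = yes here
... | no u≢v = no λ { here → u≢v refl }
walk? u v (suc d) with Fin.any? (λ j → walk? (swap1 u j) v d)
... | yes (j , walk) = yes (step (j , refl) walk)
... | no none = no λ { (step (j , refl) walk) → none (j , walk) }

distinct? : (v : Vertex m) → Dec (Distinct v)
distinct? v = map′ (λ distinct {p} {q} → distinct p q) (λ distinct p q → distinct {p} {q})
  (Fin.all? λ p → Fin.all? λ q → lookup v p ≟ lookup v q →-dec p ≟ q)

V-finite : ∀ m ω → ∃[ s ] HasSize (V (suc m) ω) s
V-finite m ω = _ , HasSize-filter V? (vectors (allFin (suc m)) (suc m))
  (vectors-unique _ (Unique.allFin⁺ (suc m)) (suc m)) (vectors-complete _ ∈.∈-allFin)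
  where
  V? : Decidable (V (suc m) ω)
  V? v = map′ (distinct⇒isPerm v) (isPerm⇒distinct v) (distinct? v) ×-dec least? (walk? v (identity (suc m))) ω

module Contraction {n : ℕ} (k : Fin (suc n)) where

  -- The symbol i ≠ 1 of the paper, with symbols counted from 0.
  I : Fin (suc (suc n))
  I = suc k

  extendAt : Vertex (suc n) → Fin (suc (suc n)) → Fin (suc (suc n))
  extendAt w p with p ≟ I
  ... | yes _ = I
  ... | no _ = punchIn I (lookup w (pinch k p))

  extend : Vertex (suc n) → Vertex (suc (suc n))
  extend w = tabulate (extendAt w)

  lookup-extend-I : (w : Vertex (suc n)) → lookup (extend w) I ≡ I
  lookup-extend-I w rewrite Vec.lookup∘tabulate (extendAt w) I with I ≟ I
  ... | yes _ = refl
  ... | no I≢I = ⊥-elim (I≢I refl)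

  lookup-extend-punchIn : (w : Vertex (suc n)) (q : Fin (suc n)) →
                          lookup (extend w) (punchIn I q) ≡ punchIn I (lookup w q)
  lookup-extend-punchIn w q rewrite Vec.lookup∘tabulate (extendAt w) (punchIn I q) with punchIn I q ≟ I
  ... | yes eq = ⊥-elim (Fin.punchInᵢ≢i I q eq)
  ... | no _ = cong (punchIn I ∘ lookup w) (pinch-punchIn k q)

  -- next x p follows x from p, stepping over I; so contract x deletes I from its
  -- cycle in x and relabels the remaining symbols by pinch k.
  next : Vertex (suc (suc n)) → Fin (suc (suc n)) → Fin (suc (suc n))
  next x p with lookup x p ≟ I
  ... | yes _ = lookup x I
  ... | no _ = lookup x p

  contract : Vertex (suc (suc n)) → Vertex (suc n)
  contract x = tabulate (pinch k ∘ next x ∘ punchIn I)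

  next-other : (x : Vertex (suc (suc n))) (p : Fin (suc (suc n))) → lookup x p ≢ I → next x p ≡ lookup x p
  next-other x p xp≢I with lookup x p ≟ I
  ... | yes xp≡I = ⊥-elim (xp≢I xp≡I)
  ... | no _ = refl

  next-I : (x : Vertex (suc (suc n))) (p : Fin (suc (suc n))) → lookup x p ≡ I → next x p ≡ lookup x I
  next-I x p xp≡I with lookup x p ≟ I
  ... | yes _ = refl
  ... | no xp≢I = ⊥-elim (xp≢I xp≡I)

  next-cong : (x y : Vertex (suc (suc n))) (p p′ : Fin (suc (suc n))) → lookup x I ≡ lookup y I → lookup x p ≡ lookup y p′ →
              next x p ≡ next y p′
  next-cong x y p p′ xI≡yI xp≡yp with lookup x p ≟ I | lookup y p′ ≟ I
  ... | yes _ | yes _ = xI≡yI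
  ... | no _ | no _ = xp≡yp
  ... | yes xp≡I | no yp≢I = ⊥-elim (yp≢I (trans (sym xp≡yp) xp≡I))
  ... | no xp≢I | yes yp≡I = ⊥-elim (xp≢I (trans xp≡yp yp≡I))

  lookup-contract : (x : Vertex (suc (suc n))) (q : Fin (suc n)) → lookup (contract x) q ≡ pinch k (next x (punchIn I q))
  lookup-contract x = Vec.lookup∘tabulate _

  transpose₀-punchIn : (j : Fin n) (q : Fin (suc n)) → transpose₀ (punchIn k j) (punchIn I q) ≡ punchIn I (transpose₀ j q)
  transpose₀-punchIn j zero = refl
  transpose₀-punchIn j (suc q) with q ≟ j
  ... | yes refl = transpose₀-self (punchIn k q)
  ... | no q≢j = transpose₀-other (punchIn k j) (punchIn k q) (q≢j ∘ Fin.punchIn-injective k q j)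

  transpose₀-I : (j : Fin n) → transpose₀ (punchIn k j) I ≡ I
  transpose₀-I j = transpose₀-other (punchIn k j) k (Fin.punchInᵢ≢i k j ∘ sym)

  extend-swap1 : (w : Vertex (suc n)) (j : Fin n) → extend (swap1 w j) ≡ swap1 (extend w) (punchIn k j)
  extend-swap1 w j = lookup-extensional _ _ λ p → at p (punchIn-cover I p)
    where
    open ≡-Reasoning
    at : ∀ p → p ≡ I ⊎ ∃[ q ] p ≡ punchIn I q → lookup (extend (swap1 w j)) p ≡ lookup (swap1 (extend w) (punchIn k j)) p
    at p (inj₁ refl) = begin
      lookup (extend (swap1 w j)) I                  ≡⟨ lookup-extend-I (swap1 w j) ⟩
      I                                              ≡⟨ lookup-extend-I w ⟨
      lookup (extend w) I                            ≡⟨ cong (lookup (extend w)) (transpose₀-I j) ⟨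
      lookup (extend w) (transpose₀ (punchIn k j) I) ≡⟨ lookup-swap1 (extend w) (punchIn k j) I ⟨
      lookup (swap1 (extend w) (punchIn k j)) I      ∎
    at p (inj₂ (q , refl)) = begin
      lookup (extend (swap1 w j)) (punchIn I q)       ≡⟨ lookup-extend-punchIn (swap1 w j) q ⟩
      punchIn I (lookup (swap1 w j) q)                ≡⟨ cong (punchIn I) (lookup-swap1 w j q) ⟩
      punchIn I (lookup w (transpose₀ j q))           ≡⟨ lookup-extend-punchIn w (transpose₀ j q) ⟨
      lookup (extend w) (punchIn I (transpose₀ j q))  ≡⟨ cong (lookup (extend w)) (transpose₀-punchIn j q) ⟨
      lookup (extend w) (transpose₀ (punchIn k j) (punchIn I q)) ≡⟨ lookup-swap1 (extend w) (punchIn k j) (punchIn I q) ⟨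
      lookup (swap1 (extend w) (punchIn k j)) (punchIn I q) ∎

  extend-identity : extend (identity (suc n)) ≡ identity (suc (suc n))
  extend-identity = lookup-extensional _ _ λ p → at p (punchIn-cover I p)
    where
    at : ∀ p → p ≡ I ⊎ ∃[ q ] p ≡ punchIn I q → lookup (extend (identity (suc n))) p ≡ lookup (identity (suc (suc n))) p
    at p (inj₁ refl) = trans (lookup-extend-I _) (sym (Vec.lookup-allFin I))
    at p (inj₂ (q , refl)) = trans (lookup-extend-punchIn _ q)
      (trans (cong (punchIn I) (Vec.lookup-allFin q)) (sym (Vec.lookup-allFin (punchIn I q))))

  contract-identity : contract (identity (suc (suc n))) ≡ identity (suc n)
  contract-identity = lookup-extensional _ _ λ q → begin
    lookup (contract id′) q              ≡⟨ lookup-contract id′ q ⟩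
    pinch k (next id′ (punchIn I q))     ≡⟨ cong (pinch k) (next-other id′ (punchIn I q) (id′q≢I q)) ⟩
    pinch k (lookup id′ (punchIn I q))   ≡⟨ cong (pinch k) (Vec.lookup-allFin (punchIn I q)) ⟩
    pinch k (punchIn I q)                ≡⟨ pinch-punchIn k q ⟩
    q                                                 ≡⟨ Vec.lookup-allFin q ⟨
    lookup (identity (suc n)) q                       ∎
    where
    open ≡-Reasoning
    id′ = identity (suc (suc n))
    id′q≢I : ∀ q → lookup id′ (punchIn I q) ≢ I
    id′q≢I q eq = Fin.punchInᵢ≢i I q (trans (sym (Vec.lookup-allFin (punchIn I q))) eq)

  contract-extend : (w : Vertex (suc n)) → contract (extend w) ≡ w
  contract-extend w = lookup-extensional _ _ λ q → begin
    lookup (contract (extend w)) q                 ≡⟨ lookup-contract (extend w) q ⟩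
    pinch k (next (extend w) (punchIn I q))        ≡⟨ cong (pinch k) (next-other (extend w) (punchIn I q) (extend-w≢I q)) ⟩
    pinch k (lookup (extend w) (punchIn I q))      ≡⟨ cong (pinch k) (lookup-extend-punchIn w q) ⟩
    pinch k (punchIn I (lookup w q))               ≡⟨ pinch-punchIn k (lookup w q) ⟩
    lookup w q                                     ∎
    where
    open ≡-Reasoning
    extend-w≢I : ∀ q → lookup (extend w) (punchIn I q) ≢ I
    extend-w≢I q eq = Fin.punchInᵢ≢i I (lookup w q) (trans (sym (lookup-extend-punchIn w q)) eq)

  extend-contract : (x : Vertex (suc (suc n))) → Distinct x → lookup x I ≡ I → extend (contract x) ≡ x
  extend-contract x x-distinct xI≡I = lookup-extensional _ _ λ p → at p (punchIn-cover I p)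
    where
    open ≡-Reasoning
    at : ∀ p → p ≡ I ⊎ ∃[ q ] p ≡ punchIn I q → lookup (extend (contract x)) p ≡ lookup x p
    at p (inj₁ refl) = trans (lookup-extend-I _) (sym xI≡I)
    at p (inj₂ (q , refl)) = begin
      lookup (extend (contract x)) (punchIn I q)                   ≡⟨ lookup-extend-punchIn (contract x) q ⟩
      punchIn I (lookup (contract x) q)                            ≡⟨ cong (punchIn I) (lookup-contract x q) ⟩
      punchIn I (pinch k (next x (punchIn I q)))                   ≡⟨ cong (punchIn I ∘ pinch k) (next-other x (punchIn I q) xq≢I) ⟩
      punchIn I (pinch k (lookup x (punchIn I q)))                 ≡⟨ punchIn-pinch k _ xq≢I ⟩
      lookup x (punchIn I q)                                       ∎
      where
      xq≢I : lookup x (punchIn I q) ≢ I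
      xq≢I eq = Fin.punchInᵢ≢i I q (x-distinct (trans eq (sym xI≡I)))

  contract-swap1-other : (x : Vertex (suc (suc n))) (j : Fin n) → contract (swap1 x (punchIn k j)) ≡ swap1 (contract x) j
  contract-swap1-other x j = lookup-extensional _ _ λ q → begin
    lookup (contract x′) q                                   ≡⟨ lookup-contract x′ q ⟩
    pinch k (next x′ (punchIn I q))                          ≡⟨ cong (pinch k) (next-cong x′ x _ _ x′I≡xI x′≡x∘τ) ⟩
    pinch k (next x (punchIn I (transpose₀ j q)))            ≡⟨ lookup-contract x (transpose₀ j q) ⟨
    lookup (contract x) (transpose₀ j q)                     ≡⟨ lookup-swap1 (contract x) j q ⟨
    lookup (swap1 (contract x) j) q                          ∎
    where
    open ≡-Reasoning
    x′ = swap1 x (punchIn k j)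
    x′I≡xI : lookup x′ I ≡ lookup x I
    x′I≡xI = trans (lookup-swap1 x (punchIn k j) I) (cong (lookup x) (transpose₀-I j))
    x′≡x∘τ : ∀ {q} → lookup x′ (punchIn I q) ≡ lookup x (punchIn I (transpose₀ j q))
    x′≡x∘τ {q} = trans (lookup-swap1 x (punchIn k j) (punchIn I q)) (cong (lookup x) (transpose₀-punchIn j q))

  lookup-swap1-I-I : (x : Vertex (suc (suc n))) → lookup (swap1 x k) I ≡ lookup x zero
  lookup-swap1-I-I x = trans (lookup-swap1 x k I) (cong (lookup x) (transpose₀-self k))

  lookup-swap1-I-other : (x : Vertex (suc (suc n))) (q : Fin n) →
                         lookup (swap1 x k) (suc (punchIn k q)) ≡ lookup x (suc (punchIn k q))
  lookup-swap1-I-other x q = trans (lookup-swap1 x k _) (cong (lookup x) (transpose₀-other k (punchIn k q) (Fin.punchInᵢ≢i k q)))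

  contract-swap1-head : (x : Vertex (suc (suc n))) → Distinct x → lookup x zero ≡ I → contract (swap1 x k) ≡ contract x
  contract-swap1-head x x-distinct x0≡I = lookup-extensional _ _ λ q →
    trans (lookup-contract x′ q) (trans (cong (pinch k) (at q)) (sym (lookup-contract x q)))
    where
    x′ = swap1 x k
    at : ∀ q → next x′ (punchIn I q) ≡ next x (punchIn I q)
    at zero = trans (next-other x′ zero (xI≢I ∘ trans (sym (lookup-swap1 x k zero))))
                    (trans (lookup-swap1 x k zero) (sym (next-I x zero x0≡I)))
      where
      xI≢I : lookup x I ≢ I
      xI≢I eq with x-distinct (trans x0≡I (sym eq))
      ... | ()
    at (suc q) = trans (next-other x′ _ (xq≢I ∘ trans (sym (lookup-swap1-I-other x q))))
                       (trans (lookup-swap1-I-other x q) (sym (next-other x _ xq≢I)))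
      where
      xq≢I : lookup x (suc (punchIn k q)) ≢ I
      xq≢I eq with x-distinct (trans eq (sym x0≡I))
      ... | ()

  contract-swap1-fixed : (x : Vertex (suc (suc n))) → Distinct x → lookup x I ≡ I → contract (swap1 x k) ≡ contract x
  contract-swap1-fixed x x-distinct xI≡I = begin
    contract (swap1 x k)           ≡⟨ contract-swap1-head (swap1 x k) (swap1-distinct x k x-distinct) x′0≡I ⟨
    contract (swap1 (swap1 x k) k) ≡⟨ cong contract (swap1-involutive x k) ⟩
    contract x                     ∎
    where
    open ≡-Reasoning
    x′0≡I : lookup (swap1 x k) zero ≡ I
    x′0≡I = trans (lookup-swap1 x k zero) xI≡I

  contract-swap1-moving : (x : Vertex (suc (suc n))) (j : Fin n) → Distinct x →
                          lookup x zero ≢ I → lookup x I ≢ I → lookup x (suc (punchIn k j)) ≡ I →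
                          contract (swap1 x k) ≡ swap1 (contract x) j
  contract-swap1-moving x j x-distinct x0≢I xI≢I xj≡I = lookup-extensional _ _ λ q →
    trans (lookup-contract x′ q) (trans (cong (pinch k) (at q))
      (sym (trans (lookup-swap1 (contract x) j q) (lookup-contract x (transpose₀ j q)))))
    where
    x′ = swap1 x k
    at : ∀ q → next x′ (punchIn I q) ≡ next x (punchIn I (transpose₀ j q))
    at zero = trans (next-other x′ zero (xI≢I ∘ trans (sym (lookup-swap1 x k zero))))
                    (trans (lookup-swap1 x k zero) (sym (next-I x _ xj≡I)))
    at (suc q) with q ≟ j
    ... | yes refl = trans (next-I x′ _ (trans (lookup-swap1-I-other x q) xj≡I))
                           (trans (lookup-swap1-I-I x) (sym (next-other x zero x0≢I)))
    ... | no q≢j = trans (next-other x′ _ (xq≢I ∘ trans (sym (lookup-swap1-I-other x q))))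
                         (trans (lookup-swap1-I-other x q) (sym (next-other x _ xq≢I)))
      where
      xq≢I : lookup x (suc (punchIn k q)) ≢ I
      xq≢I eq = q≢j (Fin.punchIn-injective k q j (Fin.suc-injective (x-distinct (trans eq (sym xj≡I)))))

  next≢I : (x : Vertex (suc (suc n))) → Distinct x → ∀ {p} → p ≢ I → next x p ≢ I
  next≢I x x-distinct {p} p≢I with lookup x p ≟ I
  ... | yes xp≡I = λ xI≡I → p≢I (x-distinct (trans xp≡I (sym xI≡I)))
  ... | no xp≢I = xp≢I

  next-injective : (x : Vertex (suc (suc n))) → Distinct x → ∀ {p q} → p ≢ I → q ≢ I → next x p ≡ next x q → p ≡ q
  next-injective x x-distinct {p} {q} p≢I q≢I eq with lookup x p ≟ I | lookup x q ≟ I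
  ... | yes xp≡I | yes xq≡I = x-distinct (trans xp≡I (sym xq≡I))
  ... | yes _ | no _ = ⊥-elim (q≢I (sym (x-distinct eq)))
  ... | no _ | yes _ = ⊥-elim (p≢I (x-distinct eq))
  ... | no _ | no _ = x-distinct eq

  extend-distinct : (w : Vertex (suc n)) → Distinct w → Distinct (extend w)
  extend-distinct w w-distinct {p} {q} eq = at (punchIn-cover I p) (punchIn-cover I q)
    where
    at : p ≡ I ⊎ ∃[ p′ ] p ≡ punchIn I p′ → q ≡ I ⊎ ∃[ q′ ] q ≡ punchIn I q′ → p ≡ q
    at (inj₁ refl) (inj₁ refl) = refl
    at (inj₁ refl) (inj₂ (q′ , refl)) =
      ⊥-elim (Fin.punchInᵢ≢i I _ (trans (sym (lookup-extend-punchIn w q′)) (trans (sym eq) (lookup-extend-I w))))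
    at (inj₂ (p′ , refl)) (inj₁ refl) =
      ⊥-elim (Fin.punchInᵢ≢i I _ (trans (sym (lookup-extend-punchIn w p′)) (trans eq (lookup-extend-I w))))
    at (inj₂ (p′ , refl)) (inj₂ (q′ , refl)) = cong (punchIn I) (w-distinct (Fin.punchIn-injective I _ _
      (trans (sym (lookup-extend-punchIn w p′)) (trans eq (lookup-extend-punchIn w q′)))))

  contract-distinct : (x : Vertex (suc (suc n))) → Distinct x → Distinct (contract x)
  contract-distinct x x-distinct {p} {q} eq = Fin.punchIn-injective I p q
    (next-injective x x-distinct (Fin.punchInᵢ≢i I p) (Fin.punchInᵢ≢i I q)
      (Fin.pinch-injective (next≢I′ p ∘ sym) (next≢I′ q ∘ sym)
        (trans (sym (lookup-contract x p)) (trans eq (lookup-contract x q)))))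
    where
    next≢I′ : ∀ p → next x (punchIn I p) ≢ I
    next≢I′ p = next≢I x x-distinct (Fin.punchInᵢ≢i I p)

  extend-walk : ∀ {w w′ d} → Walk w w′ d → Walk (extend w) (extend w′) d
  extend-walk here = here
  extend-walk (step (j , refl) walk) = step (punchIn k j , extend-swap1 _ j) (extend-walk walk)

  -- Swaps away from position I act on the contraction, and so does the swap at I
  -- unless I sits at the head or at home, when the contraction is unchanged. A
  -- walk taking I from elsewhere home must pass such a pause: hence the shortcut.
  record Shadow (x y : Vertex (suc (suc n))) (d : ℕ) : Set where
    constructor shadow
    field
      {len} : ℕ
      walk : Walk (contract x) (contract y) len
      len≤ : len ≤ d
      shortcut : lookup x I ≢ I → lookup y I ≡ I → len < d

  shadow-pause : ∀ {x x′ y d} → contract x′ ≡ contract x → Shadow x′ y d → Shadow x y (suc d)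
  shadow-pause {y = y} eq (shadow {len} walk len≤ _) =
    shadow (subst (λ z → Walk z (contract y) len) eq walk) (ℕ.m≤n⇒m≤1+n len≤) (λ _ _ → s≤s len≤)

  shadow-step : ∀ {x x′ y d} (j : Fin n) → contract x′ ≡ swap1 (contract x) j →
                (lookup x I ≢ I → lookup x′ I ≢ I) → Shadow x′ y d → Shadow x y (suc d)
  shadow-step j eq moves (shadow walk len≤ shortcut) =
    shadow (step (j , eq) walk) (s≤s len≤) (λ xI≢I yI≡I → s≤s (shortcut (moves xI≢I) yI≡I))

  shadow-swap1 : ∀ {x y d} → Distinct x → (j : Fin (suc n)) → Shadow (swap1 x j) y d → Shadow x y (suc d)
  shadow-swap1 {x} x-distinct j with punchIn-cover k j
  ... | inj₂ (j′ , refl) = shadow-step j′ (contract-swap1-other x j′)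
    (λ xI≢I → xI≢I ∘ trans (sym (trans (lookup-swap1 x _ I) (cong (lookup x) (transpose₀-I j′)))))
  ... | inj₁ refl with lookup x zero ≟ I | lookup x I ≟ I
  ...   | yes x0≡I | _ = shadow-pause (contract-swap1-head x x-distinct x0≡I)
  ...   | no _ | yes xI≡I = shadow-pause (contract-swap1-fixed x x-distinct xI≡I)
  ...   | no x0≢I | no xI≢I with distinct⇒surjective x x-distinct I
  ...     | p , xp≡I with punchIn-cover I p
  ...       | inj₁ refl = ⊥-elim (xI≢I xp≡I)
  ...       | inj₂ (zero , refl) = ⊥-elim (x0≢I xp≡I)
  ...       | inj₂ (suc j′ , refl) = shadow-step j′ (contract-swap1-moving x j′ x-distinct x0≢I xI≢I xp≡I)
    (λ _ → x0≢I ∘ trans (sym (lookup-swap1-I-I x)))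

  project-walk : ∀ {x y d} → Distinct x → Walk x y d → Shadow x y d
  project-walk _ here = shadow here z≤n (λ xI≢I yI≡I → ⊥-elim (xI≢I yI≡I))
  project-walk {x} x-distinct (step (j , refl) walk) =
    shadow-swap1 x-distinct j (project-walk (swap1-distinct x j x-distinct) walk)

  embed : Vertex (suc n) → Vertex (suc (suc n))
  embed w = swap1 (extend w) k

  head-embed : (w : Vertex (suc n)) → lookup (embed w) zero ≡ I
  head-embed w = trans (lookup-swap1 (extend w) k zero) (lookup-extend-I w)

  embed-moves-I : (w : Vertex (suc n)) → lookup (embed w) I ≢ I
  embed-moves-I w eq = Fin.punchInᵢ≢i I (lookup w zero)
    (trans (sym (lookup-extend-punchIn w zero)) (trans (sym (lookup-swap1-I-I (extend w))) eq))

  embed-distinct : (w : Vertex (suc n)) → Distinct w → Distinct (embed w)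
  embed-distinct w w-distinct = swap1-distinct (extend w) k (extend-distinct w w-distinct)

  embed-injective : (w w′ : Vertex (suc n)) → embed w ≡ embed w′ → w ≡ w′
  embed-injective w w′ eq = begin
    w                                       ≡⟨ contract-extend w ⟨
    contract (extend w)                     ≡⟨ cong contract (swap1-involutive (extend w) k) ⟨
    contract (swap1 (embed w) k)            ≡⟨ cong (λ z → contract (swap1 z k)) eq ⟩
    contract (swap1 (embed w′) k)           ≡⟨ cong contract (swap1-involutive (extend w′) k) ⟩
    contract (extend w′)                    ≡⟨ contract-extend w′ ⟩
    w′                                      ∎
    where open ≡-Reasoning

  contract-embed : (w : Vertex (suc n)) → Distinct w → contract (embed w) ≡ w
  contract-embed w w-distinct =
    trans (contract-swap1-fixed (extend w) (extend-distinct w w-distinct) (lookup-extend-I w)) (contract-extend w)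

  embed-contract : (v : Vertex (suc (suc n))) → Distinct v → lookup v zero ≡ I → embed (contract v) ≡ v
  embed-contract v v-distinct v0≡I = begin
    swap1 (extend (contract v)) k  ≡⟨ cong (λ z → swap1 (extend z) k) (contract-swap1-head v v-distinct v0≡I) ⟨
    swap1 (extend (contract v′)) k ≡⟨ cong (λ z → swap1 z k) (extend-contract v′ (swap1-distinct v k v-distinct) v′I≡I) ⟩
    swap1 v′ k                     ≡⟨ swap1-involutive v k ⟩
    v                              ∎
    where
    open ≡-Reasoning
    v′ = swap1 v k
    v′I≡I : lookup v′ I ≡ I
    v′I≡I = trans (lookup-swap1-I-I v) v0≡I

  embed-walk : ∀ {w d} → Walk w (identity (suc n)) d → Walk (embed w) (identity (suc (suc n))) (suc d)
  embed-walk {w} {d} walk = step (k , sym (swap1-involutive (extend w) k))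
    (subst (λ z → Walk (extend w) z d) extend-identity (extend-walk walk))

  unembed-walk : ∀ {w d} → Distinct w → Walk (embed w) (identity (suc (suc n))) d →
                 ∃[ e ] (e < d × Walk w (identity (suc n)) e)
  unembed-walk {w} w-distinct walk with project-walk (embed-distinct w w-distinct) walk
  ... | shadow {e} walk′ _ shortcut = e , shortcut (embed-moves-I w) (Vec.lookup-allFin I) ,
    subst₂ (λ u v → Walk u v e) (contract-embed w w-distinct) contract-identity walk′

  weight-embed : ∀ {w e} → Distinct w → Weight w e → Weight (embed w) (suc e)
  weight-embed w-distinct = least-suc embed-walk (unembed-walk w-distinct)

  weight-cell : ∀ {v ω} → Distinct v → lookup v zero ≡ I → Weight v ω → ∃[ e ] (ω ≡ suc e × Weight (contract v) e)
  weight-cell {v} {ω} v-distinct v0≡I v-weight =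
    least-pred embed-walk (unembed-walk (contract-distinct v v-distinct))
      (subst (λ z → Weight z ω) (sym (embed-contract v v-distinct v0≡I)) v-weight)

open Contraction using (extend; contract; lookup-contract; next-other; extend-walk; extend-contract; extend-identity; contract-distinct;
                        embed; head-embed; embed-distinct; embed-injective; embed-contract; weight-embed; weight-cell)

ShortWalk : Vertex m → ℕ → Set
ShortWalk {m} x b = ∃[ L ] (Walk x (identity m) L × L * 2 ≤ b)

ShortWalk-weaken : ∀ {x : Vertex m} {b b′} → b ≤ b′ → ShortWalk x b → ShortWalk x b′
ShortWalk-weaken b≤b′ (L , walk , L≤b) = L , walk , ℕ.≤-trans L≤b b≤b′

ShortWalk-step : ∀ {x : Vertex (suc m)} {b} j → ShortWalk (swap1 x j) b → ShortWalk x (2 + b)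
ShortWalk-step j (L , walk , L≤b) = suc L , step (j , refl) walk , s≤s (s≤s L≤b)

ShortWalk-fixed : ∀ {x : Vertex (suc (suc m))} {b} (k : Fin (suc m)) → Distinct x → lookup x (suc k) ≡ suc k →
                  ShortWalk (contract k x) b → ShortWalk x b
ShortWalk-fixed {x = x} k x-distinct fixed (L , walk , L≤b) =
  L , subst₂ (λ u v → Walk u v L) (extend-contract k x x-distinct fixed) (extend-identity k) (extend-walk k walk) , L≤b

-- Induction on the dimension: a fixed point is deleted for free, a misplaced
-- head is sent home by one swap, and if the head is the only fixed point, two
-- swaps create a fixed point whose deletion leaves a misplaced head.
short-walk : ∀ m (x : Vertex (suc m)) → Distinct x → ShortWalk x (m * 3)
short-walk-fixed : ∀ m (x : Vertex (suc (suc m))) (a : Fin (suc m)) → Distinct x → lookup x (suc a) ≡ suc a →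
                   ShortWalk x (m * 3)
short-walk-head : ∀ m (x : Vertex (suc (suc m))) (a : Fin (suc m)) → Distinct x → lookup x zero ≡ suc a →
                  ShortWalk x (2 + m * 3)
short-walk-only-head-fixed : ∀ m (x : Vertex (suc (suc m))) → Distinct x → lookup x zero ≡ zero →
                             (∀ a → lookup x (suc a) ≢ suc a) → (b : Fin m) → lookup x (suc zero) ≡ suc (suc b) →
                             ShortWalk x (suc m * 3)

short-walk zero (zero ∷ []) _ = 0 , here , z≤n
short-walk (suc m) x x-distinct with Fin.any? (λ a → lookup x (suc a) ≟ suc a)
... | yes (a , fixed) = ShortWalk-weaken (ℕ.m≤n+m (m * 3) 3) (short-walk-fixed m x a x-distinct fixed)
... | no no-fixed with lookup x zero in x0
...   | suc a = ShortWalk-weaken (ℕ.n≤1+n _) (short-walk-head m x a x-distinct x0)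
...   | zero with lookup x (suc zero) in x1
...     | suc zero = ⊥-elim (no-fixed (zero , x1))
...     | suc (suc b) = short-walk-only-head-fixed m x x-distinct x0 (λ a fixed → no-fixed (a , fixed)) b x1
...     | zero with x-distinct (trans x1 (sym x0))
...       | ()

short-walk-fixed m x a x-distinct fixed = ShortWalk-fixed a x-distinct fixed (short-walk m (contract a x) (contract-distinct a x x-distinct))

short-walk-head m x a x-distinct x0≡a = ShortWalk-step a (short-walk-fixed m (swap1 x a) a (swap1-distinct x a x-distinct)
  (trans (lookup-swap1 x a (suc a)) (trans (cong (lookup x) (transpose₀-self a)) x0≡a)))

short-walk-only-head-fixed (suc m) x x-distinct x0≡0 no-fixed b x1≡b =
  ShortWalk-step zero (ShortWalk-step (suc b) (ShortWalk-fixed (suc b) x₂-distinct x₂-fixed (y-short (lookup y zero) refl)))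
  where
  x₂ = swap1 (swap1 x zero) (suc b)
  y = contract (suc b) x₂
  t = lookup x (suc (suc b))
  x₂-distinct : Distinct x₂
  x₂-distinct = swap1-distinct (swap1 x zero) (suc b) (swap1-distinct x zero x-distinct)
  x₂-fixed : lookup x₂ (suc (suc b)) ≡ suc (suc b)
  x₂-fixed = trans (lookup-swap1 (swap1 x zero) (suc b) (suc (suc b)))
    (trans (cong (lookup (swap1 x zero)) (transpose₀-self (suc b))) (trans (lookup-swap1 x zero zero) x1≡b))
  x₂0≡t : lookup x₂ zero ≡ t
  x₂0≡t = trans (lookup-swap1 (swap1 x zero) (suc b) zero)
    (trans (lookup-swap1 x zero (suc (suc b))) (cong (lookup x) (transpose₀-other zero (suc b) λ ())))
  t≢0 : t ≢ zero
  t≢0 t≡0 with x-distinct (trans t≡0 (sym x0≡0))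
  ... | ()
  t≢b : t ≢ suc (suc b)
  t≢b = no-fixed (suc b)
  y0≡t : lookup y zero ≡ pinch (suc b) t
  y0≡t = trans (lookup-contract (suc b) x₂ zero)
    (cong (pinch (suc b)) (trans (next-other (suc b) x₂ zero (t≢b ∘ trans (sym x₂0≡t))) x₂0≡t))
  y-short : ∀ c → lookup y zero ≡ c → ShortWalk y (2 + m * 3)
  y-short zero y0≡0 = ⊥-elim (t≢0 (pinch≡0 (suc b) t t≢b (trans (sym y0≡t) y0≡0)))
  y-short (suc c) y0≡c = short-walk-head m y c (contract-distinct (suc b) x₂ x₂-distinct) y0≡c

weight-upper-bound : ∀ {x : Vertex (suc m)} {e} → Distinct x → Weight x e → e * 2 ≤ m * 3
weight-upper-bound {m} {x} x-distinct (_ , shortest) with short-walk m x x-distinct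
... | L , walk , L≤ = ℕ.≤-trans (ℕ.*-monoˡ-≤ 2 (ℕ.≮⇒≥ λ L<e → shortest L L<e walk)) L≤

data Even : ℕ → Set where
  even-zero : Even 0
  even-2+ : Even n → Even (suc (suc n))

Even-*2 : ∀ q → Even (q * 2)
Even-*2 zero = even-zero
Even-*2 (suc q) = even-2+ (Even-*2 q)

%2≡0⇒Even : ∀ n → n % 2 ≡ 0 → Even n
%2≡0⇒Even n n%2≡0 with m%n≡0⇒n∣m n 2 n%2≡0
... | divides q refl = Even-*2 q

module PairCost {A : Set} (_≟ᴬ_ : DecidableEquality A) where

  mismatch : A → A → ℕ
  mismatch a b = if does (a ≟ᴬ b) then 0 else 1

  -- A crossed pair (b, a) against the target (a, b) costs three swaps, not two,
  -- to repair; this extra unit is where the factor 3/2 comes from.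
  crossed : A → A → A → A → ℕ
  crossed a b a′ b′ = if does (a ≟ᴬ b′) ∧ does (b ≟ᴬ a′) then 1 else 0

  pairCost : A → A → A → A → ℕ
  pairCost a b a′ b′ = mismatch a a′ + mismatch b b′ + crossed a b a′ b′

  cost : Vec A l → Vec A l → ℕ
  cost [] [] = 0
  cost (a ∷ []) (a′ ∷ []) = 0
  cost (a ∷ b ∷ xs) (a′ ∷ b′ ∷ ys) = pairCost a b a′ b′ + cost xs ys

  mismatch≤1 : ∀ a b → mismatch a b ≤ 1
  mismatch≤1 a b with a ≟ᴬ b
  ... | yes _ = z≤n
  ... | no _ = s≤s z≤n

  mismatch-≢ : ∀ {a b} → a ≢ b → mismatch a b ≡ 1
  mismatch-≢ {a} {b} a≢b with a ≟ᴬ b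
  ... | yes a≡b = ⊥-elim (a≢b a≡b)
  ... | no _ = refl

  mismatch-refl : ∀ a → mismatch a a ≡ 0
  mismatch-refl a with a ≟ᴬ a
  ... | yes _ = refl
  ... | no a≢a = ⊥-elim (a≢a refl)

  private
    ≤-suc-left : ∀ x y z w → x ≤ 1 → x + y + 0 ≤ suc (z + y + w)
    ≤-suc-left x y z w x≤1 = begin
      x + y + 0      ≡⟨ ℕ.+-identityʳ (x + y) ⟩
      x + y          ≤⟨ ℕ.+-monoˡ-≤ y x≤1 ⟩
      suc y          ≤⟨ s≤s (ℕ.m≤n+m y z) ⟩
      suc (z + y)    ≤⟨ s≤s (ℕ.m≤m+n (z + y) w) ⟩
      suc (z + y + w) ∎
      where open ℕ.≤-Reasoning

    ≤-suc-right : ∀ x y z w → y ≤ 1 → x + y + 0 ≤ suc (x + z + w)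
    ≤-suc-right x y z w y≤1 = begin
      x + y + 0      ≡⟨ ℕ.+-identityʳ (x + y) ⟩
      x + y          ≤⟨ ℕ.+-monoʳ-≤ x y≤1 ⟩
      x + 1          ≡⟨ ℕ.+-comm x 1 ⟩
      suc x          ≤⟨ s≤s (ℕ.m≤m+n x z) ⟩
      suc (x + z)    ≤⟨ s≤s (ℕ.m≤m+n (x + z) w) ⟩
      suc (x + z + w) ∎
      where open ℕ.≤-Reasoning

  pairCost-replaceˡ : ∀ a b a′ b′ v → a′ ≢ b′ → v ≢ b → pairCost a b a′ b′ ≤ suc (pairCost v b a′ b′)
  pairCost-replaceˡ a b a′ b′ v a′≢b′ v≢b with a ≟ᴬ b′ | b ≟ᴬ a′
  ... | yes refl | yes refl rewrite mismatch-≢ (a′≢b′ ∘ sym) | mismatch-≢ a′≢b′ | mismatch-≢ v≢b =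
    s≤s (s≤s (s≤s z≤n))
  ... | yes _ | no _ = ≤-suc-left _ _ (mismatch v a′) _ (mismatch≤1 a a′)
  ... | no _ | _ = ≤-suc-left _ _ (mismatch v a′) _ (mismatch≤1 a a′)

  pairCost-replaceʳ : ∀ a b a′ b′ v → a′ ≢ b′ → v ≢ a → pairCost a b a′ b′ ≤ suc (pairCost a v a′ b′)
  pairCost-replaceʳ a b a′ b′ v a′≢b′ v≢a with a ≟ᴬ b′ | b ≟ᴬ a′
  ... | yes refl | yes refl rewrite mismatch-≢ (a′≢b′ ∘ sym) | mismatch-≢ a′≢b′ | mismatch-≢ v≢a =
    s≤s (s≤s (s≤s z≤n))
  ... | yes _ | no _ = ≤-suc-right _ _ (mismatch v b′) _ (mismatch≤1 b b′)
  ... | no _ | _ = ≤-suc-right _ _ (mismatch v b′) _ (mismatch≤1 b b′)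

  cost-replace : (xs ys : Vec A l) (j : Fin l) (v : A) → Distinct ys → (∀ p → lookup xs p ≢ v) →
                 cost xs ys ≤ suc (cost (xs [ j ]≔ v) ys)
  cost-replace (a ∷ []) (a′ ∷ []) zero v _ _ = z≤n
  cost-replace (a ∷ b ∷ xs) (a′ ∷ b′ ∷ ys) zero v ys-distinct v∉xs =
    ℕ.+-monoˡ-≤ (cost xs ys) (pairCost-replaceˡ a b a′ b′ v (distinct-pair ys-distinct) (v∉xs (suc zero) ∘ sym))
  cost-replace (a ∷ b ∷ xs) (a′ ∷ b′ ∷ ys) (suc zero) v ys-distinct v∉xs =
    ℕ.+-monoˡ-≤ (cost xs ys) (pairCost-replaceʳ a b a′ b′ v (distinct-pair ys-distinct) (v∉xs zero ∘ sym))
  cost-replace (a ∷ b ∷ xs) (a′ ∷ b′ ∷ ys) (suc (suc j)) v ys-distinct v∉xs = begin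
    pairCost a b a′ b′ + cost xs ys                   ≤⟨ ℕ.+-monoʳ-≤ (pairCost a b a′ b′) rest ⟩
    pairCost a b a′ b′ + suc (cost (xs [ j ]≔ v) ys)  ≡⟨ ℕ.+-suc (pairCost a b a′ b′) _ ⟩
    suc (pairCost a b a′ b′ + cost (xs [ j ]≔ v) ys)  ∎
    where
    open ℕ.≤-Reasoning
    rest : cost xs ys ≤ suc (cost (xs [ j ]≔ v) ys)
    rest = cost-replace xs ys j v (distinct-drop₂ ys-distinct) (λ p → v∉xs (suc (suc p)))

  cost-self : (ys : Vec A l) → Distinct ys → cost ys ys ≡ 0
  cost-self [] _ = refl
  cost-self (a ∷ []) _ = refl
  cost-self (a ∷ b ∷ ys) ys-distinct
    rewrite mismatch-refl a | mismatch-refl b | cost-self ys (distinct-drop₂ ys-distinct)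
    with a ≟ᴬ b
  ... | yes a≡b = ⊥-elim (distinct-pair ys-distinct a≡b)
  ... | no _ = refl

  swapPairs : Vec A l → Vec A l
  swapPairs [] = []
  swapPairs (a ∷ []) = a ∷ []
  swapPairs (a ∷ b ∷ xs) = b ∷ a ∷ swapPairs xs

  swapPairs-↭ : (xs : Vec A l) → toList (swapPairs xs) ↭ toList xs
  swapPairs-↭ [] = ↭-refl
  swapPairs-↭ (a ∷ []) = ↭-refl
  swapPairs-↭ (a ∷ b ∷ xs) = swap b a (swapPairs-↭ xs)

  cost-swapPairs : (ys : Vec A l) → Even l → Distinct ys → l * 3 ≤ cost (swapPairs ys) ys * 2
  cost-swapPairs [] even-zero _ = z≤n
  cost-swapPairs (a ∷ b ∷ ys) (even-2+ l-even) ys-distinct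
    rewrite mismatch-≢ (distinct-pair ys-distinct ∘ sym) | mismatch-≢ (distinct-pair ys-distinct)
    with b ≟ᴬ b | a ≟ᴬ a
  ... | yes _ | yes _ = s≤s (s≤s (s≤s (s≤s (s≤s (s≤s (cost-swapPairs ys l-even (distinct-drop₂ ys-distinct)))))))
  ... | no b≢b | _ = ⊥-elim (b≢b refl)
  ... | _ | no a≢a = ⊥-elim (a≢a refl)

module _ {m : ℕ} where
  open PairCost {Fin (suc m)} _≟_

  cost-walk : ∀ {x : Vertex (suc m)} {d} → Distinct x → Walk x (identity (suc m)) d →
              cost (tail x) (tail (identity (suc m))) ≤ d
  cost-walk _ here = ℕ.≤-reflexive (cost-self (tail (identity (suc m))) (distinct-tail identity-distinct))
  cost-walk {x = x₀ ∷ xs} x-distinct (step (j , refl) walk) = ℕ.≤-trans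
    (cost-replace xs _ j x₀ (distinct-tail identity-distinct) (λ p xp≡x₀ → Fin.0≢1+n (x-distinct (sym xp≡x₀))))
    (s≤s (cost-walk (swap1-distinct (x₀ ∷ xs) j x-distinct) walk))

diameter-lower-bound : ∀ {D} → IsDiameter (suc (suc n)) D → Even (suc n) → suc n * 3 ≤ D * 2
diameter-lower-bound {n} {D} (_ , maximal) even =
  via (least-witness (walk? s (identity _)) (proj₁ (proj₂ (short-walk (suc n) s s-distinct))))
  where
  open PairCost {Fin (suc (suc n))} _≟_
  ys = tail (identity (suc (suc n)))
  s = zero ∷ swapPairs ys
  s-perm : IsPerm s
  s-perm = prep zero (swapPairs-↭ ys)
  s-distinct : Distinct s
  s-distinct = isPerm⇒distinct s s-perm
  via : ∃[ d ] Dist s (identity _) d → suc n * 3 ≤ D * 2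
  via (d , dist) = begin
    suc n * 3                  ≤⟨ cost-swapPairs ys even (distinct-tail identity-distinct) ⟩
    cost (swapPairs ys) ys * 2 ≤⟨ ℕ.*-monoˡ-≤ 2 (cost-walk s-distinct (proj₁ dist)) ⟩
    d * 2                      ≤⟨ ℕ.*-monoˡ-≤ 2 (maximal s (identity _) d s-perm ↭-refl dist) ⟩
    D * 2                      ∎
    where open ℕ.≤-Reasoning

cell-size : ∀ n (k : Fin (suc n)) e → ∃[ s ] (HasSize (Vi (suc n) (suc k) (suc e)) s × HasSize (V (suc n) e) s)
cell-size n k e with V-finite n e
... | s , V-size = s , HasSize-image (embed k) (embed-injective k _ _) into onto V-size , V-size
  where
  into : ∀ {w} → V (suc n) e w → Vi (suc n) (suc k) (suc e) (embed k w)
  into {w} (w-perm , w-weight) =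
    (distinct⇒isPerm _ (embed-distinct k w w-distinct) , weight-embed k w-distinct w-weight) ,
    trans (head≡lookup-zero (embed k w)) (head-embed k w)
    where w-distinct = isPerm⇒distinct w w-perm
  onto : ∀ {v} → Vi (suc n) (suc k) (suc e) v → ∃[ w ] (V (suc n) e w × embed k w ≡ v)
  onto {v} ((v-perm , v-weight) , head≡k) = contract k v , (contract-perm , contract-weight) , embed-contract k v v-distinct v0≡k
    where
    v-distinct : Distinct v
    v-distinct = isPerm⇒distinct v v-perm
    v0≡k : lookup v zero ≡ suc k
    v0≡k = trans (sym (head≡lookup-zero v)) head≡k
    contract-perm : IsPerm (contract k v)
    contract-perm = distinct⇒isPerm (contract k v) (contract-distinct k v v-distinct)
    contract-weight : Weight (contract k v) e
    contract-weight = let (_ , 1+e≡1+e′ , weight) = weight-cell k v-distinct v0≡k v-weight in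
      subst (Weight (contract k v)) (ℕ.suc-injective (sym 1+e≡1+e′)) weight

no-cell-of-weight-zero : ∀ n (k : Fin (suc n)) v → ¬ Vi (suc n) (suc k) 0 v
no-cell-of-weight-zero n k v ((_ , here , _) , ())

no-cell-at-diameter : ∀ n (k : Fin (suc n)) {D} → IsDiameter (suc (suc n)) D → Even (suc n) → ∀ v → ¬ Vi (suc n) (suc k) D v
no-cell-at-diameter n k {D} diameter even v ((v-perm , v-weight) , head≡k) =
  below-diameter (weight-cell k v-distinct (trans (sym (head≡lookup-zero v)) head≡k) v-weight)
  where
  v-distinct : Distinct v
  v-distinct = isPerm⇒distinct v v-perm
  below-diameter : ¬ (∃[ e ] (D ≡ suc e × Weight (contract k v) e))
  below-diameter (e , D≡1+e , contract-weight) = ℕ.<-irrefl refl (ℕ.<-≤-trans (s≤s (s≤s (s≤s upper)))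
    (subst (λ d → suc n * 3 ≤ d * 2) D≡1+e (diameter-lower-bound diameter even)))
    where
    upper : e * 2 ≤ n * 3
    upper = weight-upper-bound (contract-distinct k v v-distinct) contract-weight

theorem8 : (n : ℕ) → 1 ≤ n → (D : ℕ) → IsDiameter (suc n) D →
    (i : Fin (suc n)) → i ≢ Fin.zero →
      HasSize (Vi n i 0) 0
      × (∀ ω → 1 ≤ ω → ω ≤ 2 * (D / 2) →
           ∃[ k ] (HasSize (Vi n i ω) k × HasSize (V n (ω ∸ 1)) k))
      × (n % 2 ≡ 0 → HasSize (Vi n i D) 0)
theorem8 (suc n) _ D diameter zero 0≢0 = ⊥-elim (0≢0 refl)
theorem8 (suc n) _ D diameter (suc k) _ =
  HasSize-empty (no-cell-of-weight-zero n k) ,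
  (λ { (suc e) _ _ → cell-size n k e }) ,
  λ n%2≡0 → HasSize-empty (no-cell-at-diameter n k diameter (%2≡0⇒Even (suc n) n%2≡0))
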